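{- Let $B_{1/12} = \{(1,0),(0,1),(-1,-1)\} + 6\mathbb{Z}^2$. Then $B_{1/12}$ is B-stable but not I-stable, and $\overline{\delta}(B_{1/12}) = 1/12$.
   Context: A lattice triangle is the convex hull in $\mathbb{R}^2$ of three non-collinear points of $\mathbb{Z}^2$. A triangle is a set $T = \Delta \cap \mathbb{Z}^2$ for a lattice triangle $\Delta$. A triangle is minimal if it contains exactly $4$ points of $\mathbb{Z}^2$; a minimal triangle is a border triangle if its non-vertex point lies on the boundary of $\Delta$, and an internal triangle if that point lies in the interior of $\Delta$. A set $S \subseteq \mathbb{Z}^2$ is B-stable if no border triangle has exactly three of its points in $S$; I-stable if no internal triangle has exactly three of its points in $S$. For integers $a\le b$, $[a,b]=\{i\in\mathbb{Z}: a\le i\le b\}$. The upper density of $X\subseteq\mathbb{Z}^2$ is $\overline{\delta}(X)=\limsup_{n\to\infty}|X\cap[-n,n]^2|/|[-n,n]^2|$. -}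

module Defs where

open import Data.Nat as ℕ using (ℕ; suc)
open import Data.Integer as ℤ using (ℤ; +_; _-_; _*_; _+_; _<_; _≤_; 0ℤ)
open import Data.Integer.Divisibility.Signed using (_∣_; _∣?_)
open import Data.Rational as ℚ using (ℚ; _/_) renaming (_≤_ to _≤ℚ_; _<_ to _<ℚ_; _+_ to _+ℚ_; _-_ to _-ℚ_)
open import Data.Product using (_×_; _,_; Σ; ∃; ∃-syntax)
open import Data.Sum using (_⊎_)
open import Data.List using (List; map; upTo; concatMap; filter; length)
open import Relation.Nullary using (¬_; Dec)
open import Relation.Nullary.Decidable using (_×-dec_; _⊎-dec_)
open import Relation.Unary using (Pred; Decidable)
open import Relation.Binary.PropositionalEquality using (_≡_; _≢_)
open import Level using (0ℓ)

Pt : Set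
Pt = ℤ × ℤ

Subset : Set₁
Subset = Pred Pt 0ℓ

_-ᵖ_ : Pt → Pt → Pt
(a , b) -ᵖ (c , d) = (a - c , b - d)

det : Pt → Pt → ℤ
det (a , b) (c , d) = a * d - b * c

orient : Pt → Pt → Pt → ℤ
orient a b c = det (b -ᵖ a) (c -ᵖ a)

NonCollinear : Pt → Pt → Pt → Set
NonCollinear a b c = orient a b c ≢ 0ℤ

-- p lies in the closed lattice triangle Δ = conv{a,b,c} (a,b,c non-collinear):
-- p is weakly on the same side of each edge as the opposite vertex.
InΔ : Pt → Pt → Pt → Pt → Set
InΔ a b c p =
  (0ℤ ≤ orient a b c * orient a b p) ×
  (0ℤ ≤ orient a b c * orient b c p) ×
  (0ℤ ≤ orient a b c * orient c a p)

InIntΔ : Pt → Pt → Pt → Pt → Set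
InIntΔ a b c p =
  (0ℤ < orient a b c * orient a b p) ×
  (0ℤ < orient a b c * orient b c p) ×
  (0ℤ < orient a b c * orient c a p)

MinimalTriangle : Pt → Pt → Pt → Pt → Set
MinimalTriangle a b c q =
  NonCollinear a b c ×
  InΔ a b c q × q ≢ a × q ≢ b × q ≢ c ×
  (∀ p → InΔ a b c p → (p ≡ a ⊎ p ≡ b ⊎ p ≡ c ⊎ p ≡ q))

BorderTriangle : Pt → Pt → Pt → Pt → Set
BorderTriangle a b c q = MinimalTriangle a b c q × ¬ InIntΔ a b c q

InternalTriangle : Pt → Pt → Pt → Pt → Set
InternalTriangle a b c q = MinimalTriangle a b c q × InIntΔ a b c q

ExactlyThreeIn : Subset → Pt → Pt → Pt → Pt → Set
ExactlyThreeIn S a b c q =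
  (¬ S a × S b × S c × S q) ⊎
  (S a × ¬ S b × S c × S q) ⊎
  (S a × S b × ¬ S c × S q) ⊎
  (S a × S b × S c × ¬ S q)

B-stable : Subset → Set
B-stable S = ∀ a b c q → BorderTriangle a b c q → ¬ ExactlyThreeIn S a b c q

I-stable : Subset → Set
I-stable S = ∀ a b c q → InternalTriangle a b c q → ¬ ExactlyThreeIn S a b c q

InCoset6 : Pt → Pt → Set
InCoset6 (gx , gy) (x , y) = (+ 6 ∣ (x - gx)) × (+ 6 ∣ (y - gy))

B₁₂ : Subset
B₁₂ p = InCoset6 (+ 1 , + 0) p ⊎ InCoset6 (+ 0 , + 1) p ⊎ InCoset6 (ℤ.- + 1 , ℤ.- + 1) p

inCoset6? : ∀ g → Decidable (InCoset6 g)
inCoset6? (gx , gy) (x , y) = (+ 6 ∣? (x - gx)) ×-dec (+ 6 ∣? (y - gy))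

B₁₂? : Decidable B₁₂
B₁₂? p = inCoset6? (+ 1 , + 0) p ⊎-dec (inCoset6? (+ 0 , + 1) p ⊎-dec inCoset6? (ℤ.- + 1 , ℤ.- + 1) p)

interval : ℕ → List ℤ
interval n = map (λ i → + i - + n) (upTo (suc (2 ℕ.* n)))

box : ℕ → List Pt
box n = concatMap (λ x → map (λ y → (x , y)) (interval n)) (interval n)

countIn : (X : Subset) → Decidable X → ℕ → ℕ
countIn X X? n = length (filter X? (box n))

ratio : (X : Subset) → Decidable X → ℕ → ℚ
ratio X X? n = (+ countIn X X? n) / (suc (2 ℕ.* n) ℕ.* suc (2 ℕ.* n))

LimsupEq : (ℕ → ℚ) → ℚ → Set
LimsupEq f L =
  (∀ ε → ℚ.0ℚ <ℚ ε → ∃[ N ] ∀ n → N ℕ.≤ n → f n ≤ℚ L +ℚ ε) ×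
  (∀ ε → ℚ.0ℚ <ℚ ε → ∀ N → ∃[ n ] (N ℕ.≤ n × L -ℚ ε ≤ℚ f n))

UpperDensityEq : (X : Subset) → Decidable X → ℚ → Set
UpperDensityEq X X? L = LimsupEq (ratio X X?) L

module Submission where

-- B₁₂ is the union of the cosets g + 6ℤ² for g ∈ {(1,0), (0,1), (-1,-1)}, and these g sum to 0.
-- A minimal triangle Δ has only four lattice points, so two distinct ones are never congruent
-- mod 6 (the segment joining them would carry seven).  Three lattice points of Δ in B₁₂ thus
-- lie in the three different cosets, and their centroid is a lattice point of Δ with even
-- coordinates, hence outside B₁₂: it must be the fourth lattice point.  But a vertex is never
-- the centroid of the other two vertices and a point of Δ, and the centroid of the three
-- vertices is interior, so this is impossible in a border triangle.  The internal triangle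
-- (1,0), (0,1), (-1,-1) around (0,0) shows that B₁₂ is not I-stable.  Finally, each residue
-- class mod 6 meets [-n, n] in (2n + 1)/6 + O(1) points, so |B₁₂ ∩ [-n, n]²| = 3 (2n + 1)²/36 + O(n).

open import Defs
open import Data.Empty using (⊥; ⊥-elim)
open import Data.Integer using (+_)
open import Data.Integer.Divisibility.Signed
  using (_∣_; divides; _∣?_; ∣-refl; ∣-trans; ∣m∣n⇒∣m+n; ∣m∣n⇒∣m-n; ∣m+n∣m⇒∣n; ∣m⇒∣m*n)
open import Data.Product using (_×_; _,_; proj₁; proj₂; ∃-syntax; ∃₂)
open import Data.Rational using (_/_)
open import Data.Sum using (_⊎_; inj₁; inj₂; [_,_])
open import Function using (_∘_)
open import Relation.Binary.PropositionalEquality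
  using (_≡_; _≢_; refl; sym; trans; cong; cong₂; subst; subst₂; ≢-sym; module ≡-Reasoning)
open import Relation.Nullary using (¬_; Dec; yes; no)
open import Relation.Nullary.Decidable using (_×-dec_; _⊎-dec_; toWitnessFalse)

module Stability where
  open import Data.Fin as Fin using (Fin; zero; suc; toℕ)
  import Data.Fin.Properties as Fin
  open import Data.Integer as ℤ
    using (ℤ; +_; -[1+_]; +[1+_]; 0ℤ; _+_; _-_; _*_; -_; _≤_; _<_; +≤+; +<+)
  import Data.Integer.Properties as ℤ
  open import Algebra.Properties.AbelianGroup ℤ.+-0-abelianGroup using (∙-cancelˡ)
  open import Data.Integer.Tactic.RingSolver using (solve-∀)
  open import Data.List using (List; []; _∷_; length; lookup)
  open import Data.List.Membership.Propositional using (_∈_)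
  open import Data.List.Relation.Unary.Any using (here; there; index)
  open import Data.List.Relation.Unary.Any.Properties using (lookup-index)
  open import Data.Nat as ℕ using (ℕ; z≤n; s≤s)
  import Data.Nat.Properties as ℕ

  0≤i*j : ∀ {i j} → 0ℤ ≤ i → 0ℤ ≤ j → 0ℤ ≤ i * j
  0≤i*j {+ m} {+ n} _ _ = subst (0ℤ ≤_) (ℤ.pos-* m n) (+≤+ z≤n)

  0≤i*i : ∀ i → 0ℤ ≤ i * i
  0≤i*i (+ n)    = 0≤i*j {+ n} {+ n} (+≤+ z≤n) (+≤+ z≤n)
  0≤i*i -[1+ n ] = +≤+ z≤n

  0<i*i : ∀ {i} → i ≢ 0ℤ → 0ℤ < i * i
  0<i*i {+ ℕ.zero}  i≢0 = ⊥-elim (i≢0 refl)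
  0<i*i {+[1+ n ]}  _   = +<+ (s≤s z≤n)
  0<i*i { -[1+ n ]} _   = +<+ (s≤s z≤n)

  j≡0⇒0≤i*j : ∀ i {j} → j ≡ 0ℤ → 0ℤ ≤ i * j
  j≡0⇒0≤i*j i refl = subst (0ℤ ≤_) (sym (ℤ.*-zeroʳ i)) ℤ.≤-refl

  j≡i⇒0≤i*j : ∀ i {j} → j ≡ i → 0ℤ ≤ i * j
  j≡i⇒0≤i*j i refl = 0≤i*i i

  0≤k*i⇒0≤i : ∀ k {i} .{{_ : ℤ.Positive k}} → 0ℤ ≤ k * i → 0ℤ ≤ i
  0≤k*i⇒0≤i k {i} h = ℤ.*-cancelˡ-≤-pos 0ℤ i k (subst (_≤ k * i) (sym (ℤ.*-zeroʳ k)) h)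

  0<k*i⇒0<i : ∀ k {i} .{{_ : ℤ.NonNegative k}} → 0ℤ < k * i → 0ℤ < i
  0<k*i⇒0<i k {i} h = ℤ.*-cancelˡ-<-nonNeg k (subst (_< k * i) (sym (ℤ.*-zeroʳ k)) h)

  orient-rotate : ∀ a b c → orient a b c ≡ orient b c a
  orient-rotate (a₁ , a₂) (b₁ , b₂) (c₁ , c₂) = identity a₁ a₂ b₁ b₂ c₁ c₂
    where
    identity : ∀ (a₁ a₂ b₁ b₂ c₁ c₂ : ℤ) →
      (b₁ - a₁) * (c₂ - a₂) - (b₂ - a₂) * (c₁ - a₁) ≡ (c₁ - b₁) * (a₂ - b₂) - (c₂ - b₂) * (a₁ - b₁)
    identity = solve-∀

  orient-repeat₁₂ : ∀ a c → orient a a c ≡ 0ℤ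
  orient-repeat₁₂ (a₁ , a₂) (c₁ , c₂) = identity a₁ a₂ c₁ c₂
    where
    identity : ∀ (a₁ a₂ c₁ c₂ : ℤ) → (a₁ - a₁) * (c₂ - a₂) - (a₂ - a₂) * (c₁ - a₁) ≡ 0ℤ
    identity = solve-∀

  orient-repeat₁₃ : ∀ a b → orient a b a ≡ 0ℤ
  orient-repeat₁₃ (a₁ , a₂) (b₁ , b₂) = identity a₁ a₂ b₁ b₂
    where
    identity : ∀ (a₁ a₂ b₁ b₂ : ℤ) → (b₁ - a₁) * (a₂ - a₂) - (b₂ - a₂) * (a₁ - a₁) ≡ 0ℤ
    identity = solve-∀

  orient-repeat₂₃ : ∀ a b → orient a b b ≡ 0ℤ
  orient-repeat₂₃ (a₁ , a₂) (b₁ , b₂) = identity a₁ a₂ b₁ b₂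
    where
    identity : ∀ (a₁ a₂ b₁ b₂ : ℤ) → (b₁ - a₁) * (b₂ - a₂) - (b₂ - a₂) * (b₁ - a₁) ≡ 0ℤ
    identity = solve-∀

  orient-cyclic-sum : ∀ a b c p → orient a b p + orient b c p + orient c a p ≡ orient a b c
  orient-cyclic-sum (a₁ , a₂) (b₁ , b₂) (c₁ , c₂) (p₁ , p₂) = identity a₁ a₂ b₁ b₂ c₁ c₂ p₁ p₂
    where
    identity : ∀ (a₁ a₂ b₁ b₂ c₁ c₂ p₁ p₂ : ℤ) →
      (b₁ - a₁) * (p₂ - a₂) - (b₂ - a₂) * (p₁ - a₁) + ((c₁ - b₁) * (p₂ - b₂) - (c₂ - b₂) * (p₁ - b₁))
        + ((a₁ - c₁) * (p₂ - c₂) - (a₂ - c₂) * (p₁ - c₁))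
      ≡ (b₁ - a₁) * (c₂ - a₂) - (b₂ - a₂) * (c₁ - a₁)
    identity = solve-∀

  record Barycentre (p : Pt) (u v w : ℤ) (x y z : Pt) : Set where
    constructor barycentre
    field
      first  : (u + v + w) * proj₁ p ≡ u * proj₁ x + v * proj₁ y + w * proj₁ z
      second : (u + v + w) * proj₂ p ≡ u * proj₂ x + v * proj₂ y + w * proj₂ z

  Centroid : Pt → Pt → Pt → Pt → Set
  Centroid m x y z = Barycentre m (+ 1) (+ 1) (+ 1) x y z

  orient-barycentre : ∀ a b {p u v w x y z} → Barycentre p u v w x y z →
    (u + v + w) * orient a b p ≡ u * orient a b x + v * orient a b y + w * orient a b z
  orient-barycentre (a₁ , a₂) (b₁ , b₂) {p₁ , p₂} {u} {v} {w} {x₁ , x₂} {y₁ , y₂} {z₁ , z₂} (barycentre e₁ e₂) =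
    begin
      n * ((b₁ - a₁) * (p₂ - a₂) - (b₂ - a₂) * (p₁ - a₁))
    ≡⟨ scale n a₁ a₂ b₁ b₂ p₁ p₂ ⟩
      (b₁ - a₁) * (n * p₂ - n * a₂) - (b₂ - a₂) * (n * p₁ - n * a₁)
    ≡⟨ cong₂ (λ s t → (b₁ - a₁) * (t - n * a₂) - (b₂ - a₂) * (s - n * a₁)) e₁ e₂ ⟩
      (b₁ - a₁) * (u * x₂ + v * y₂ + w * z₂ - n * a₂) - (b₂ - a₂) * (u * x₁ + v * y₁ + w * z₁ - n * a₁)
    ≡⟨ expand u v w a₁ a₂ b₁ b₂ x₁ x₂ y₁ y₂ z₁ z₂ ⟩
      u * ((b₁ - a₁) * (x₂ - a₂) - (b₂ - a₂) * (x₁ - a₁)) + v * ((b₁ - a₁) * (y₂ - a₂) - (b₂ - a₂) * (y₁ - a₁))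
        + w * ((b₁ - a₁) * (z₂ - a₂) - (b₂ - a₂) * (z₁ - a₁))
    ∎
    where
    open ≡-Reasoning
    n = u + v + w
    scale : ∀ (n a₁ a₂ b₁ b₂ p₁ p₂ : ℤ) →
      n * ((b₁ - a₁) * (p₂ - a₂) - (b₂ - a₂) * (p₁ - a₁))
      ≡ (b₁ - a₁) * (n * p₂ - n * a₂) - (b₂ - a₂) * (n * p₁ - n * a₁)
    scale = solve-∀
    expand : ∀ (u v w a₁ a₂ b₁ b₂ x₁ x₂ y₁ y₂ z₁ z₂ : ℤ) →
      (b₁ - a₁) * (u * x₂ + v * y₂ + w * z₂ - (u + v + w) * a₂)
        - (b₂ - a₂) * (u * x₁ + v * y₁ + w * z₁ - (u + v + w) * a₁)
      ≡ u * ((b₁ - a₁) * (x₂ - a₂) - (b₂ - a₂) * (x₁ - a₁))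
        + v * ((b₁ - a₁) * (y₂ - a₂) - (b₂ - a₂) * (y₁ - a₁))
        + w * ((b₁ - a₁) * (z₂ - a₂) - (b₂ - a₂) * (z₁ - a₁))
    expand = solve-∀

  nonneg-combination : ∀ {n s u v w i j k} → 0ℤ < n → 0ℤ ≤ u → 0ℤ ≤ v → 0ℤ ≤ w →
    n * s ≡ u * i + v * j + w * k → 0ℤ ≤ i → 0ℤ ≤ j → 0ℤ ≤ k → 0ℤ ≤ s
  nonneg-combination {n} n>0 u≥0 v≥0 w≥0 eq i≥0 j≥0 k≥0 =
    0≤k*i⇒0≤i n {{ℤ.positive n>0}}
      (subst (0ℤ ≤_) (sym eq) (ℤ.+-mono-≤ (ℤ.+-mono-≤ (0≤i*j u≥0 i≥0) (0≤i*j v≥0 j≥0)) (0≤i*j w≥0 k≥0)))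

  InΔ-barycentre : ∀ {a b c p u v w x y z} → 0ℤ ≤ u → 0ℤ ≤ v → 0ℤ ≤ w → 0ℤ < u + v + w →
    Barycentre p u v w x y z → InΔ a b c x → InΔ a b c y → InΔ a b c z → InΔ a b c p
  InΔ-barycentre {a} {b} {c} {p} {u} {v} {w} {x} {y} {z} u≥0 v≥0 w≥0 n>0 bar
    (x₁ , x₂ , x₃) (y₁ , y₂ , y₃) (z₁ , z₂ , z₃) =
    side a b x₁ y₁ z₁ , side b c x₂ y₂ z₂ , side c a x₃ y₃ z₃
    where
    D = orient a b c
    side : ∀ e f → 0ℤ ≤ D * orient e f x → 0ℤ ≤ D * orient e f y → 0ℤ ≤ D * orient e f z → 0ℤ ≤ D * orient e f p
    side e f = nonneg-combination n>0 u≥0 v≥0 w≥0 (begin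
        (u + v + w) * (D * orient e f p)       ≡⟨ swap D (u + v + w) (orient e f p) ⟩
        D * ((u + v + w) * orient e f p)       ≡⟨ cong (D *_) (orient-barycentre e f bar) ⟩
        D * (u * orient e f x + v * orient e f y + w * orient e f z)
          ≡⟨ distrib D u v w (orient e f x) (orient e f y) (orient e f z) ⟩
        u * (D * orient e f x) + v * (D * orient e f y) + w * (D * orient e f z) ∎)
      where
      open ≡-Reasoning
      swap : ∀ (D n s : ℤ) → n * (D * s) ≡ D * (n * s)
      swap = solve-∀
      distrib : ∀ (D u v w i j k : ℤ) → D * (u * i + v * j + w * k) ≡ u * (D * i) + v * (D * j) + w * (D * k)
      distrib = solve-∀

  centroid-InΔ : ∀ {a b c m x y z} → Centroid m x y z → InΔ a b c x → InΔ a b c y → InΔ a b c z → InΔ a b c m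
  centroid-InΔ {a} {b} {c} = InΔ-barycentre {a} {b} {c} (+≤+ z≤n) (+≤+ z≤n) (+≤+ z≤n) (+<+ (s≤s z≤n))

  InΔ-vertex₁ : ∀ a b c → InΔ a b c a
  InΔ-vertex₁ a b c =
    j≡0⇒0≤i*j D (orient-repeat₁₃ a b) , j≡i⇒0≤i*j D (sym (orient-rotate a b c)) , j≡0⇒0≤i*j D (orient-repeat₂₃ c a)
    where D = orient a b c

  InΔ-vertex₂ : ∀ a b c → InΔ a b c b
  InΔ-vertex₂ a b c =
    j≡0⇒0≤i*j D (orient-repeat₂₃ a b) , j≡0⇒0≤i*j D (orient-repeat₁₃ b c) ,
    j≡i⇒0≤i*j D (sym (trans (orient-rotate a b c) (orient-rotate b c a)))
    where D = orient a b c

  InΔ-vertex₃ : ∀ a b c → InΔ a b c c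
  InΔ-vertex₃ a b c = j≡i⇒0≤i*j D refl , j≡0⇒0≤i*j D (orient-repeat₂₃ b c) , j≡0⇒0≤i*j D (orient-repeat₁₃ c a)
    where D = orient a b c

  InΔ-rotate : ∀ a b c p → InΔ a b c p → InΔ b c a p
  InΔ-rotate a b c p (s₁ , s₂ , s₃) =
    subst (λ D → (0ℤ ≤ D * orient b c p) × (0ℤ ≤ D * orient c a p) × (0ℤ ≤ D * orient a b p))
      (orient-rotate a b c) (s₂ , s₃ , s₁)

  distinct-vertices : ∀ {a b c} → NonCollinear a b c → a ≢ b × b ≢ c × a ≢ c
  distinct-vertices {a} {b} {c} nc =
    (λ { refl → nc (orient-repeat₁₂ a c) }) ,
    (λ { refl → nc (orient-repeat₂₃ a b) }) ,
    (λ { refl → nc (orient-repeat₁₃ a b) })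

  MinimalTriangle-rotate : ∀ {a b c q} → MinimalTriangle a b c q → MinimalTriangle b c a q
  MinimalTriangle-rotate {a} {b} {c} {q} (nc , qΔ , q≢a , q≢b , q≢c , Δ⊆) =
    nc ∘ trans (orient-rotate a b c) , InΔ-rotate a b c q qΔ , q≢b , q≢c , q≢a ,
    λ p → reorder ∘ Δ⊆ p ∘ InΔ-rotate c a b p ∘ InΔ-rotate b c a p
    where
    reorder : ∀ {p} → p ≡ a ⊎ p ≡ b ⊎ p ≡ c ⊎ p ≡ q → p ≡ b ⊎ p ≡ c ⊎ p ≡ a ⊎ p ≡ q
    reorder (inj₁ p≡a)                 = inj₂ (inj₂ (inj₁ p≡a))
    reorder (inj₂ (inj₁ p≡b))          = inj₁ p≡b
    reorder (inj₂ (inj₂ (inj₁ p≡c)))   = inj₂ (inj₁ p≡c)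
    reorder (inj₂ (inj₂ (inj₂ p≡q)))   = inj₂ (inj₂ (inj₂ p≡q))

  -- A vertex is an extreme point: orient b c · is maximal on Δ at a, and vanishes at b and c.
  vertex-not-centroid : ∀ {a b c q} → NonCollinear a b c → InΔ a b c q → ¬ Centroid a b c q
  vertex-not-centroid {a} {b} {c} {q} nc (qab , _ , qca) cen =
    ℤ.<-irrefl refl (ℤ.≤-<-trans (ℤ.+-mono-≤ qab qca)
      (subst (_< 0ℤ) (sym sum≡) (ℤ.neg-mono-< (ℤ.+-mono-< (0<i*i nc) (0<i*i nc)))))
    where
    open ≡-Reasoning
    D = orient a b c
    A = orient a b q
    X = orient b c q
    C = orient c a q
    3D≡X : + 3 * D ≡ + 1 * 0ℤ + + 1 * 0ℤ + + 1 * X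
    3D≡X = begin
      + 3 * D                                                ≡⟨ cong (+ 3 *_) (orient-rotate a b c) ⟩
      + 3 * orient b c a                                     ≡⟨ orient-barycentre b c cen ⟩
      + 1 * orient b c b + + 1 * orient b c c + + 1 * X
        ≡⟨ cong₂ (λ s t → + 1 * s + + 1 * t + + 1 * X) (orient-repeat₁₃ b c) (orient-repeat₂₃ b c) ⟩
      + 1 * 0ℤ + + 1 * 0ℤ + + 1 * X ∎
    sum≡ : D * A + D * C ≡ - (D * D + D * D)
    sum≡ = begin
      D * A + D * C                                          ≡⟨ split D A X C ⟩
      D * (A + X + C) - D * (+ 1 * 0ℤ + + 1 * 0ℤ + + 1 * X)
        ≡⟨ cong₂ (λ s t → D * s - D * t) (orient-cyclic-sum a b c q) (sym 3D≡X) ⟩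
      D * D - D * (+ 3 * D)                                  ≡⟨ collect D ⟩
      - (D * D + D * D) ∎
      where
      split : ∀ (D A X C : ℤ) → D * A + D * C ≡ D * (A + X + C) - D * (+ 1 * 0ℤ + + 1 * 0ℤ + + 1 * X)
      split = solve-∀
      collect : ∀ (D : ℤ) → D * D - D * (+ 3 * D) ≡ - (D * D + D * D)
      collect = solve-∀

  Centroid-rotate : ∀ {m x y z} → Centroid m x y z → Centroid m y z x
  Centroid-rotate {x = x} {y} {z} (barycentre e₁ e₂) =
    barycentre (trans e₁ (rotate (proj₁ x) (proj₁ y) (proj₁ z))) (trans e₂ (rotate (proj₂ x) (proj₂ y) (proj₂ z)))
    where
    rotate : ∀ (i j k : ℤ) → + 1 * i + + 1 * j + + 1 * k ≡ + 1 * j + + 1 * k + + 1 * i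
    rotate = solve-∀

  centroid-side : ∀ a b c {m} → Centroid m a b c → + 3 * orient a b m ≡ orient a b c
  centroid-side a b c {m} cen = begin
    + 3 * orient a b m                                            ≡⟨ orient-barycentre a b cen ⟩
    + 1 * orient a b a + + 1 * orient a b b + + 1 * orient a b c
      ≡⟨ cong₂ (λ s t → + 1 * s + + 1 * t + + 1 * orient a b c) (orient-repeat₁₃ a b) (orient-repeat₂₃ a b) ⟩
    + 1 * 0ℤ + + 1 * 0ℤ + + 1 * orient a b c                        ≡⟨ simplify (orient a b c) ⟩
    orient a b c ∎
    where
    open ≡-Reasoning
    simplify : ∀ (D : ℤ) → + 1 * 0ℤ + + 1 * 0ℤ + + 1 * D ≡ D
    simplify = solve-∀

  centroid-interior : ∀ {a b c m} → NonCollinear a b c → Centroid m a b c → InIntΔ a b c m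
  centroid-interior {a} {b} {c} nc cen =
    side (centroid-side a b c cen) ,
    side (trans (centroid-side b c a (Centroid-rotate cen)) (sym (orient-rotate a b c))) ,
    side (trans (centroid-side c a b (Centroid-rotate (Centroid-rotate cen)))
                (sym (trans (orient-rotate a b c) (orient-rotate b c a))))
    where
    D = orient a b c
    side : ∀ {s} → + 3 * s ≡ D → 0ℤ < D * s
    side {s} 3s≡D = 0<k*i⇒0<i (+ 3) (subst (0ℤ <_) (trans (cong (D *_) (sym 3s≡D)) (swap D s)) (0<i*i nc))
      where
      swap : ∀ (D s : ℤ) → D * (+ 3 * s) ≡ + 3 * (D * s)
      swap = solve-∀

  infixl 6 _+ᵖ_
  infixr 7 _·ᵖ_

  _+ᵖ_ : Pt → Pt → Pt
  (x₁ , x₂) +ᵖ (y₁ , y₂) = (x₁ + y₁ , x₂ + y₂)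

  _·ᵖ_ : ℤ → Pt → Pt
  k ·ᵖ (x₁ , x₂) = (k * x₁ , k * x₂)

  CongruentMod : ℕ → Pt → Pt → Set
  CongruentMod n x y = ∃[ d ] y ≡ x +ᵖ (+ n ·ᵖ d)

  InΔ-segment : ∀ {a b c} x d {n} (k : Fin (ℕ.suc n)) → 0 ℕ.< n →
    InΔ a b c x → InΔ a b c (x +ᵖ (+ n ·ᵖ d)) → InΔ a b c (x +ᵖ (+ toℕ k ·ᵖ d))
  InΔ-segment {a} {b} {c} (x₁ , x₂) (d₁ , d₂) {n} k n>0 xΔ yΔ =
    InΔ-barycentre {a} {b} {c} {p} {+ n - + toℕ k} {+ toℕ k} {0ℤ} {x₁ , x₂} {(x₁ , x₂) +ᵖ (+ n ·ᵖ (d₁ , d₂))} {x₁ , x₂}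
      (ℤ.i≤j⇒0≤j-i (+≤+ (Fin.toℕ≤pred[n] k))) (+≤+ z≤n) ℤ.≤-refl
      (subst (0ℤ <_) (sym (weights (+ n) (+ toℕ k))) (+<+ n>0))
      (barycentre (on-segment (+ n) (+ toℕ k) x₁ d₁) (on-segment (+ n) (+ toℕ k) x₂ d₂))
      xΔ yΔ xΔ
    where
    p = (x₁ , x₂) +ᵖ (+ toℕ k ·ᵖ (d₁ , d₂))
    weights : ∀ (n k : ℤ) → n - k + k + 0ℤ ≡ n
    weights = solve-∀
    on-segment : ∀ (n k x d : ℤ) → (n - k + k + 0ℤ) * (x + k * d) ≡ (n - k) * x + k * (x + n * d) + 0ℤ * x
    on-segment = solve-∀

  x+id≡x+jd⇒x+kd≡x : ∀ {x d i j} (k : ℤ) → i ≢ j → x +ᵖ (i ·ᵖ d) ≡ x +ᵖ (j ·ᵖ d) → x +ᵖ (k ·ᵖ d) ≡ x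
  x+id≡x+jd⇒x+kd≡x {x₁ , x₂} {d₁ , d₂} {i} {j} k i≢j eq =
    cong₂ _,_ (no-shift x₁ (step-zero x₁ (cong proj₁ eq))) (no-shift x₂ (step-zero x₂ (cong proj₂ eq)))
    where
    step-zero : ∀ s {δ} → s + i * δ ≡ s + j * δ → δ ≡ 0ℤ
    step-zero s {δ} eq with δ ℤ.≟ 0ℤ
    ... | yes δ≡0 = δ≡0
    ... | no δ≢0  = ⊥-elim (i≢j (ℤ.*-cancelʳ-≡ i j δ {{ℤ.≢-nonZero δ≢0}} (∙-cancelˡ s (i * δ) (j * δ) eq)))
    no-shift : ∀ s {δ} → δ ≡ 0ℤ → s + k * δ ≡ s
    no-shift s refl = trans (cong (_+_ s) (ℤ.*-zeroʳ k)) (ℤ.+-identityʳ s)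

  -- If Δ has at most n lattice points, the n + 1 lattice points x, x + d, …, x + n d of the
  -- segment [x, x + n d] ⊆ Δ cannot be distinct.
  congruent-points-coincide : ∀ {a b c x y} (ps : List Pt) {n} → (∀ p → InΔ a b c p → p ∈ ps) →
    length ps ℕ.≤ n → InΔ a b c x → InΔ a b c y → CongruentMod n x y → x ≡ y
  congruent-points-coincide {a} {b} {c} {x} {y} ps {n} Δ⊆ps |ps|≤n xΔ yΔ (d , y≡x+nd) =
    collapse (Fin.pigeonhole (s≤s |ps|≤n) position)
    where
    point : Fin (ℕ.suc n) → Pt
    point k = x +ᵖ (+ toℕ k ·ᵖ d)

    nonempty : ∀ {p : Pt} {ps} → p ∈ ps → 0 ℕ.< length ps
    nonempty (here _)  = s≤s z≤n
    nonempty (there _) = s≤s z≤n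

    point∈Δ : ∀ k → InΔ a b c (point k)
    point∈Δ k = InΔ-segment {a} {b} {c} x d k (ℕ.<-≤-trans (nonempty (Δ⊆ps x xΔ)) |ps|≤n)
      xΔ (subst (InΔ a b c) y≡x+nd yΔ)

    position : Fin (ℕ.suc n) → Fin (length ps)
    position k = index (Δ⊆ps (point k) (point∈Δ k))

    collapse : ∃₂ (λ i j → i Fin.< j × position i ≡ position j) → x ≡ y
    collapse (i , j , i<j , same-position) =
      sym (trans y≡x+nd (x+id≡x+jd⇒x+kd≡x (+ n) (Fin.<⇒≢ i<j ∘ Fin.toℕ-injective ∘ ℤ.+-injective) point-i≡point-j))
      where
      point-i≡point-j : point i ≡ point j
      point-i≡point-j = trans (lookup-index (Δ⊆ps (point i) (point∈Δ i)))
        (trans (cong (lookup ps) same-position) (sym (lookup-index (Δ⊆ps (point j) (point∈Δ j)))))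

  generator : Fin 3 → Pt
  generator zero             = (+ 1 , + 0)
  generator (suc zero)       = (+ 0 , + 1)
  generator (suc (suc zero)) = (- + 1 , - + 1)

  B₁₂⇒coset : ∀ {p} → B₁₂ p → ∃[ i ] InCoset6 (generator i) p
  B₁₂⇒coset (inj₁ p∈)        = zero , p∈
  B₁₂⇒coset (inj₂ (inj₁ p∈)) = suc zero , p∈
  B₁₂⇒coset (inj₂ (inj₂ p∈)) = suc (suc zero) , p∈

  distinct-generators-sum : ∀ {i j k} → i ≢ j → j ≢ k → i ≢ k → generator i +ᵖ generator j +ᵖ generator k ≡ (0ℤ , 0ℤ)
  distinct-generators-sum {zero}             {zero}             i≢j _   _   = ⊥-elim (i≢j refl)
  distinct-generators-sum {suc zero}         {suc zero}         i≢j _   _   = ⊥-elim (i≢j refl)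
  distinct-generators-sum {suc (suc zero)}   {suc (suc zero)}   i≢j _   _   = ⊥-elim (i≢j refl)
  distinct-generators-sum {j = zero}           {zero}           _   j≢k _   = ⊥-elim (j≢k refl)
  distinct-generators-sum {j = suc zero}       {suc zero}       _   j≢k _   = ⊥-elim (j≢k refl)
  distinct-generators-sum {j = suc (suc zero)} {suc (suc zero)} _   j≢k _   = ⊥-elim (j≢k refl)
  distinct-generators-sum {zero}             {k = zero}         _   _   i≢k = ⊥-elim (i≢k refl)
  distinct-generators-sum {suc zero}         {k = suc zero}     _   _   i≢k = ⊥-elim (i≢k refl)
  distinct-generators-sum {suc (suc zero)}   {k = suc (suc zero)} _ _   i≢k = ⊥-elim (i≢k refl)
  distinct-generators-sum {zero}           {suc zero}       {suc (suc zero)} _ _ _ = refl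
  distinct-generators-sum {zero}           {suc (suc zero)} {suc zero}       _ _ _ = refl
  distinct-generators-sum {suc zero}       {zero}           {suc (suc zero)} _ _ _ = refl
  distinct-generators-sum {suc zero}       {suc (suc zero)} {zero}           _ _ _ = refl
  distinct-generators-sum {suc (suc zero)} {zero}           {suc zero}       _ _ _ = refl
  distinct-generators-sum {suc (suc zero)} {suc zero}       {zero}           _ _ _ = refl

  coset-congruent : ∀ {g x y} → InCoset6 g x → InCoset6 g y → CongruentMod 6 x y
  coset-congruent {g₁ , g₂} {x₁ , x₂} {y₁ , y₂} (divides s₁ ex₁ , divides s₂ ex₂) (divides t₁ ey₁ , divides t₂ ey₂) =
    (t₁ - s₁ , t₂ - s₂) , cong₂ _,_ (coordinate g₁ x₁ y₁ s₁ t₁ ex₁ ey₁) (coordinate g₂ x₂ y₂ s₂ t₂ ex₂ ey₂)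
    where
    coordinate : ∀ g x y s t → x - g ≡ s * + 6 → y - g ≡ t * + 6 → y ≡ x + + 6 * (t - s)
    coordinate g x y s t ex ey = begin
      y                            ≡⟨ split x y g ⟩
      x + ((y - g) - (x - g))      ≡⟨ cong₂ (λ i j → x + (i - j)) ey ex ⟩
      x + (t * + 6 - s * + 6)      ≡⟨ collect x s t ⟩
      x + + 6 * (t - s)            ∎
      where
      open ≡-Reasoning
      split : ∀ (x y g : ℤ) → y ≡ x + ((y - g) - (x - g))
      split = solve-∀
      collect : ∀ (x s t : ℤ) → x + (t * + 6 - s * + 6) ≡ x + + 6 * (t - s)
      collect = solve-∀

  -- x + y + z ≡ g + h + k ≡ 0 (mod 6), so the centroid (x + y + z) / 3 is an even lattice point.
  coset-centroid : ∀ {g h k x y z} → g +ᵖ h +ᵖ k ≡ (0ℤ , 0ℤ) →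
    InCoset6 g x → InCoset6 h y → InCoset6 k z → ∃[ m ] Centroid m x y z × + 2 ∣ proj₁ m × + 2 ∣ proj₂ m
  coset-centroid {g₁ , g₂} {h₁ , h₂} {k₁ , k₂} {x₁ , x₂} {y₁ , y₂} {z₁ , z₂} sum≡0
    (divides s₁ ex₁ , divides s₂ ex₂) (divides t₁ ey₁ , divides t₂ ey₂) (divides r₁ ez₁ , divides r₂ ez₂) =
    (+ 2 * (s₁ + t₁ + r₁) , + 2 * (s₂ + t₂ + r₂)) ,
    barycentre (coordinate g₁ h₁ k₁ x₁ y₁ z₁ s₁ t₁ r₁ (cong proj₁ sum≡0) ex₁ ey₁ ez₁)
               (coordinate g₂ h₂ k₂ x₂ y₂ z₂ s₂ t₂ r₂ (cong proj₂ sum≡0) ex₂ ey₂ ez₂) ,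
    ∣m⇒∣m*n _ ∣-refl , ∣m⇒∣m*n _ ∣-refl
    where
    coordinate : ∀ g h k x y z s t r → g + h + k ≡ 0ℤ → x - g ≡ s * + 6 → y - h ≡ t * + 6 → z - k ≡ r * + 6 →
      + 3 * (+ 2 * (s + t + r)) ≡ + 1 * x + + 1 * y + + 1 * z
    coordinate g h k x y z s t r g+h+k≡0 ex ey ez = sym (begin
      + 1 * x + + 1 * y + + 1 * z                        ≡⟨ split x y z g h k ⟩
      (x - g) + (y - h) + (z - k) + (g + h + k)          ≡⟨ cong₂ _+_ (cong₂ _+_ (cong₂ _+_ ex ey) ez) g+h+k≡0 ⟩
      s * + 6 + t * + 6 + r * + 6 + 0ℤ                   ≡⟨ collect s t r ⟩
      + 3 * (+ 2 * (s + t + r))                          ∎)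
      where
      open ≡-Reasoning
      split : ∀ (x y z g h k : ℤ) → + 1 * x + + 1 * y + + 1 * z ≡ (x - g) + (y - h) + (z - k) + (g + h + k)
      split = solve-∀
      collect : ∀ (s t r : ℤ) → s * + 6 + t * + 6 + r * + 6 + 0ℤ ≡ + 3 * (+ 2 * (s + t + r))
      collect = solve-∀

  2∣x⇒6∣x-g⇒2∣g : ∀ {x g} → + 2 ∣ x → + 6 ∣ x - g → + 2 ∣ g
  2∣x⇒6∣x-g⇒2∣g {x} {g} 2∣x 6∣x-g =
    subst (+ 2 ∣_) (x-[x-g]≡g x g) (∣m∣n⇒∣m-n 2∣x (∣-trans (divides (+ 3) refl) 6∣x-g))
    where
    x-[x-g]≡g : ∀ (x g : ℤ) → x - (x - g) ≡ g
    x-[x-g]≡g = solve-∀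

  even∉B₁₂ : ∀ {p} → + 2 ∣ proj₁ p → + 2 ∣ proj₂ p → ¬ B₁₂ p
  even∉B₁₂ 2∣x _ (inj₁ (6∣x-1 , _))         = toWitnessFalse {a? = + 2 ∣? + 1} _ (2∣x⇒6∣x-g⇒2∣g 2∣x 6∣x-1)
  even∉B₁₂ _ 2∣y (inj₂ (inj₁ (_ , 6∣y-1)))  = toWitnessFalse {a? = + 2 ∣? + 1} _ (2∣x⇒6∣x-g⇒2∣g 2∣y 6∣y-1)
  even∉B₁₂ 2∣x _ (inj₂ (inj₂ (6∣x+1 , _)))  = toWitnessFalse {a? = + 2 ∣? - + 1} _ (2∣x⇒6∣x-g⇒2∣g 2∣x 6∣x+1)

  B₁₂-centroid : ∀ {x y z} → B₁₂ x → B₁₂ y → B₁₂ z →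
    ¬ CongruentMod 6 x y → ¬ CongruentMod 6 y z → ¬ CongruentMod 6 x z → ∃[ m ] Centroid m x y z × ¬ B₁₂ m
  B₁₂-centroid {x} {y} {z} x∈ y∈ z∈ x≢y y≢z x≢z with B₁₂⇒coset {x} x∈ | B₁₂⇒coset {y} y∈ | B₁₂⇒coset {z} z∈
  ... | i , x∈gᵢ | j , y∈gⱼ | k , z∈gₖ =
    let m , cen , 2∣m₁ , 2∣m₂ = coset-centroid {generator i} {generator j} {generator k} {x} {y} {z}
          (distinct-generators-sum i≢j j≢k i≢k) x∈gᵢ y∈gⱼ z∈gₖ
    in m , cen , even∉B₁₂ 2∣m₁ 2∣m₂
    where
    i≢j : i ≢ j
    i≢j refl = x≢y (coset-congruent {generator i} {x} {y} x∈gᵢ y∈gⱼ)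
    j≢k : j ≢ k
    j≢k refl = y≢z (coset-congruent {generator j} {y} {z} y∈gⱼ z∈gₖ)
    i≢k : i ≢ k
    i≢k refl = x≢z (coset-congruent {generator i} {x} {z} x∈gᵢ z∈gₖ)

  corners : ∀ a b c q → MinimalTriangle a b c q → ∀ p → InΔ a b c p → p ∈ a ∷ b ∷ c ∷ q ∷ []
  corners a b c q (_ , _ , _ , _ , _ , Δ⊆) p pΔ with Δ⊆ p pΔ
  ... | inj₁ p≡a                 = here p≡a
  ... | inj₂ (inj₁ p≡b)          = there (here p≡b)
  ... | inj₂ (inj₂ (inj₁ p≡c))   = there (there (here p≡c))
  ... | inj₂ (inj₂ (inj₂ p≡q))   = there (there (there (here p≡q)))

  minimal-B₁₂-centroid : ∀ a b c q {x y z} → MinimalTriangle a b c q →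
    InΔ a b c x → InΔ a b c y → InΔ a b c z → x ≢ y → y ≢ z → x ≢ z → B₁₂ x → B₁₂ y → B₁₂ z →
    ∃[ m ] Centroid m x y z × ¬ B₁₂ m × (m ≡ a ⊎ m ≡ b ⊎ m ≡ c ⊎ m ≡ q)
  minimal-B₁₂-centroid a b c q {x} {y} {z} T@(_ , _ , _ , _ , _ , Δ⊆) xΔ yΔ zΔ x≢y y≢z x≢z x∈ y∈ z∈ =
    let m , cen , m∉ = B₁₂-centroid {x} {y} {z} x∈ y∈ z∈
                         (incongruent xΔ yΔ x≢y) (incongruent yΔ zΔ y≢z) (incongruent xΔ zΔ x≢z)
    in m , cen , m∉ , Δ⊆ m (centroid-InΔ {a} {b} {c} cen xΔ yΔ zΔ)
    where
    incongruent : ∀ {u v} → InΔ a b c u → InΔ a b c v → u ≢ v → ¬ CongruentMod 6 u v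
    incongruent {u} {v} uΔ vΔ u≢v = u≢v ∘ congruent-points-coincide {a} {b} {c} {u} {v}
      (a ∷ b ∷ c ∷ q ∷ []) (corners a b c q T) (ℕ.m≤m+n 4 2) uΔ vΔ

  -- The centroid of b, c, q would have to be the vertex a.
  B₁₂∌edge+point : ∀ a b c q → MinimalTriangle a b c q → B₁₂ b → B₁₂ c → B₁₂ q → ⊥
  B₁₂∌edge+point a b c q T@(nc , qΔ , _ , q≢b , q≢c , _) b∈ c∈ q∈ =
    locate (minimal-B₁₂-centroid a b c q T (InΔ-vertex₂ a b c) (InΔ-vertex₃ a b c) qΔ
             (proj₁ (proj₂ (distinct-vertices {a} {b} {c} nc))) (≢-sym q≢c) (≢-sym q≢b) b∈ c∈ q∈)
    where
    locate : (∃[ m ] Centroid m b c q × ¬ B₁₂ m × (m ≡ a ⊎ m ≡ b ⊎ m ≡ c ⊎ m ≡ q)) → ⊥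
    locate (m , cen , _  , inj₁ m≡a)                = vertex-not-centroid {a} {b} {c} {q} nc qΔ
                                                        (subst (λ m → Centroid m b c q) m≡a cen)
    locate (m , _   , m∉ , inj₂ (inj₁ m≡b))         = m∉ (subst B₁₂ (sym m≡b) b∈)
    locate (m , _   , m∉ , inj₂ (inj₂ (inj₁ m≡c)))  = m∉ (subst B₁₂ (sym m≡c) c∈)
    locate (m , _   , m∉ , inj₂ (inj₂ (inj₂ m≡q)))  = m∉ (subst B₁₂ (sym m≡q) q∈)

  -- The centroid of the vertices would have to be q, which then is interior.
  B₁₂∌vertices : ∀ a b c q → BorderTriangle a b c q → B₁₂ a → B₁₂ b → B₁₂ c → ⊥
  B₁₂∌vertices a b c q (T@(nc , _) , border) a∈ b∈ c∈ =
    let a≢b , b≢c , a≢c = distinct-vertices {a} {b} {c} nc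
    in locate (minimal-B₁₂-centroid a b c q T (InΔ-vertex₁ a b c) (InΔ-vertex₂ a b c) (InΔ-vertex₃ a b c)
                 a≢b b≢c a≢c a∈ b∈ c∈)
    where
    locate : (∃[ m ] Centroid m a b c × ¬ B₁₂ m × (m ≡ a ⊎ m ≡ b ⊎ m ≡ c ⊎ m ≡ q)) → ⊥
    locate (m , _   , m∉ , inj₁ m≡a)                = m∉ (subst B₁₂ (sym m≡a) a∈)
    locate (m , _   , m∉ , inj₂ (inj₁ m≡b))         = m∉ (subst B₁₂ (sym m≡b) b∈)
    locate (m , _   , m∉ , inj₂ (inj₂ (inj₁ m≡c)))  = m∉ (subst B₁₂ (sym m≡c) c∈)
    locate (m , cen , _  , inj₂ (inj₂ (inj₂ m≡q)))  = border (subst (InIntΔ a b c) m≡q (centroid-interior {a} {b} {c} nc cen))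

  B₁₂-B-stable : B-stable B₁₂
  B₁₂-B-stable a b c q (T , _) (inj₁ (_ , b∈ , c∈ , q∈)) =
    B₁₂∌edge+point a b c q T b∈ c∈ q∈
  B₁₂-B-stable a b c q (T , _) (inj₂ (inj₁ (a∈ , _ , c∈ , q∈))) =
    B₁₂∌edge+point b c a q (MinimalTriangle-rotate T) c∈ a∈ q∈
  B₁₂-B-stable a b c q (T , _) (inj₂ (inj₂ (inj₁ (a∈ , b∈ , _ , q∈)))) =
    B₁₂∌edge+point c a b q (MinimalTriangle-rotate (MinimalTriangle-rotate T)) a∈ b∈ q∈
  B₁₂-B-stable a b c q T (inj₂ (inj₂ (inj₂ (a∈ , b∈ , c∈ , _)))) =
    B₁₂∌vertices a b c q T a∈ b∈ c∈

  e₁ e₂ e₃ o : Pt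
  e₁ = (+ 1 , + 0)
  e₂ = (+ 0 , + 1)
  e₃ = (- + 1 , - + 1)
  o  = (+ 0 , + 0)

  3s≡2a+b⇒0≤s : ∀ {s a b} → + 3 * s ≡ + 2 * a + b → 0ℤ ≤ a → 0ℤ ≤ b → 0ℤ ≤ s
  3s≡2a+b⇒0≤s eq a≥0 b≥0 = 0≤k*i⇒0≤i (+ 3) (subst (0ℤ ≤_) (sym eq) (ℤ.+-mono-≤ (0≤i*j {+ 2} (+≤+ z≤n) a≥0) b≥0))

  standard-triangle-enumeration : ∀ x y → 0ℤ ≤ + 1 - x → 0ℤ ≤ x + + 1 → 0ℤ ≤ + 1 - y → 0ℤ ≤ y + + 1 →
    0ℤ ≤ orient e₁ e₂ (x , y) → 0ℤ ≤ orient e₂ e₃ (x , y) → 0ℤ ≤ orient e₃ e₁ (x , y) →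
    (x , y) ≡ e₁ ⊎ (x , y) ≡ e₂ ⊎ (x , y) ≡ e₃ ⊎ (x , y) ≡ o
  standard-triangle-enumeration (+ ℕ.suc (ℕ.suc _)) _ () _ _ _ _ _ _
  standard-triangle-enumeration -[1+ ℕ.suc _ ] _ _ () _ _ _ _ _
  standard-triangle-enumeration _ (+ ℕ.suc (ℕ.suc _)) _ _ () _ _ _ _
  standard-triangle-enumeration _ -[1+ ℕ.suc _ ] _ _ _ () _ _ _
  standard-triangle-enumeration (+ 1)    (+ 0)    _ _ _ _ _ _ _ = inj₁ refl
  standard-triangle-enumeration (+ 0)    (+ 1)    _ _ _ _ _ _ _ = inj₂ (inj₁ refl)
  standard-triangle-enumeration -[1+ 0 ] -[1+ 0 ] _ _ _ _ _ _ _ = inj₂ (inj₂ (inj₁ refl))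
  standard-triangle-enumeration (+ 0)    (+ 0)    _ _ _ _ _ _ _ = inj₂ (inj₂ (inj₂ refl))
  standard-triangle-enumeration (+ 1)    (+ 1)    _ _ _ _ () _ _
  standard-triangle-enumeration (+ 1)    -[1+ 0 ] _ _ _ _ _ _ ()
  standard-triangle-enumeration (+ 0)    -[1+ 0 ] _ _ _ _ _ _ ()
  standard-triangle-enumeration -[1+ 0 ] (+ 1)    _ _ _ _ _ () _
  standard-triangle-enumeration -[1+ 0 ] (+ 0)    _ _ _ _ _ () _

  -- With U, V, W the edge functionals orient e₁ e₂, orient e₂ e₃, orient e₃ e₁: 3 (1 - x) = 2U + W, 3 (x + 1) = 2V + W,
  -- 3 (1 - y) = 2U + V and 3 (y + 1) = 2W + V, which confines p to [-1, 1]².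
  standard-triangle-points : ∀ p → InΔ e₁ e₂ e₃ p → p ≡ e₁ ⊎ p ≡ e₂ ⊎ p ≡ e₃ ⊎ p ≡ o
  standard-triangle-points (x , y) (3U≥0 , 3V≥0 , 3W≥0) =
    standard-triangle-enumeration x y (3s≡2a+b⇒0≤s (1-x x y) U≥0 W≥0) (3s≡2a+b⇒0≤s (x+1 x y) V≥0 W≥0)
      (3s≡2a+b⇒0≤s (1-y x y) U≥0 V≥0) (3s≡2a+b⇒0≤s (y+1 x y) W≥0 V≥0) U≥0 V≥0 W≥0
    where
    U≥0 : 0ℤ ≤ orient e₁ e₂ (x , y)
    U≥0 = 0≤k*i⇒0≤i (+ 3) 3U≥0
    V≥0 : 0ℤ ≤ orient e₂ e₃ (x , y)
    V≥0 = 0≤k*i⇒0≤i (+ 3) 3V≥0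
    W≥0 : 0ℤ ≤ orient e₃ e₁ (x , y)
    W≥0 = 0≤k*i⇒0≤i (+ 3) 3W≥0
    1-x : ∀ (x y : ℤ) →
      + 3 * (+ 1 - x)
        ≡ + 2 * ((+ 0 - + 1) * (y - + 0) - (+ 1 - + 0) * (x - + 1)) + ((+ 1 - - + 1) * (y - - + 1) - (+ 0 - - + 1) * (x - - + 1))
    1-x = solve-∀
    x+1 : ∀ (x y : ℤ) →
      + 3 * (x + + 1)
        ≡ + 2 * ((- + 1 - + 0) * (y - + 1) - (- + 1 - + 1) * (x - + 0)) + ((+ 1 - - + 1) * (y - - + 1) - (+ 0 - - + 1) * (x - - + 1))
    x+1 = solve-∀
    1-y : ∀ (x y : ℤ) →
      + 3 * (+ 1 - y)
        ≡ + 2 * ((+ 0 - + 1) * (y - + 0) - (+ 1 - + 0) * (x - + 1)) + ((- + 1 - + 0) * (y - + 1) - (- + 1 - + 1) * (x - + 0))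
    1-y = solve-∀
    y+1 : ∀ (x y : ℤ) →
      + 3 * (y + + 1)
        ≡ + 2 * ((+ 1 - - + 1) * (y - - + 1) - (+ 0 - - + 1) * (x - - + 1)) + ((- + 1 - + 0) * (y - + 1) - (- + 1 - + 1) * (x - + 0))
    y+1 = solve-∀

  B₁₂-not-I-stable : ¬ I-stable B₁₂
  B₁₂-not-I-stable I-stable =
    I-stable e₁ e₂ e₃ o ((nc , oΔ , (λ ()) , (λ ()) , (λ ()) , standard-triangle-points) , o-interior)
      (inj₂ (inj₂ (inj₂ (e₁∈ , e₂∈ , e₃∈ , even∉B₁₂ {o} (divides 0ℤ refl) (divides 0ℤ refl)))))
    where
    nc : NonCollinear e₁ e₂ e₃
    nc ()
    oΔ : InΔ e₁ e₂ e₃ o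
    oΔ = +≤+ z≤n , +≤+ z≤n , +≤+ z≤n
    o-interior : InIntΔ e₁ e₂ e₃ o
    o-interior = +<+ (s≤s z≤n) , +<+ (s≤s z≤n) , +<+ (s≤s z≤n)
    e₁∈ : B₁₂ e₁
    e₁∈ = inj₁ (divides 0ℤ refl , divides 0ℤ refl)
    e₂∈ : B₁₂ e₂
    e₂∈ = inj₂ (inj₁ (divides 0ℤ refl , divides 0ℤ refl))
    e₃∈ : B₁₂ e₃
    e₃∈ = inj₂ (inj₂ (divides 0ℤ refl , divides 0ℤ refl))

module Density where
  open import Data.Integer as ℤ using (ℤ; +_; -_; -[1+_]; +[1+_]; 0ℤ; +≤+; +<+)
  import Data.Integer.Properties as ℤ
  import Data.Integer.Tactic.RingSolver as ℤ-Solver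
  open import Data.List using (List; []; _∷_; _++_; length; filter; map; concatMap; applyUpTo)
  open import Data.List.Properties
    using (length-++; filter-++; filter-≐; filter-accept; filter-reject; filter-none; length-filter; map-upTo)
  open import Data.List.Relation.Unary.All using (universal)
  open import Data.Nat as ℕ using (ℕ; zero; suc; _+_; _*_; _≤_)
  import Data.Nat.Properties as ℕ
  open import Data.Nat.Coprimality using (Coprime)
  open import Data.Nat.Tactic.RingSolver using () renaming (solve-∀ to ℕ-solve-∀)
  open import Data.Rational as ℚ using (ℚ; mkℚ; 0ℚ)
    renaming (_≤_ to _≤ℚ_; _<_ to _<ℚ_; _+_ to _+ℚ_; _-_ to _-ℚ_)
  import Data.Rational.Properties as ℚ
  open import Data.Rational.Unnormalised using (mkℚᵘ; *≤*)
  import Data.Rational.Unnormalised.Properties as ℚᵘ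
  open import Level using (0ℓ)
  open import Relation.Unary using (Pred; Decidable; _≐_)

  count : ∀ {A : Set} {P : Pred A 0ℓ} → Decidable P → List A → ℕ
  count P? xs = length (filter P? xs)

  count-accept : ∀ {A : Set} {P : Pred A 0ℓ} (P? : Decidable P) {x} xs → P x → count P? (x ∷ xs) ≡ suc (count P? xs)
  count-accept P? xs px = cong length (filter-accept P? {xs = xs} px)

  count-reject : ∀ {A : Set} {P : Pred A 0ℓ} (P? : Decidable P) {x} xs → ¬ P x → count P? (x ∷ xs) ≡ count P? xs
  count-reject P? xs ¬px = cong length (filter-reject P? {xs = xs} ¬px)

  count-++ : ∀ {A : Set} {P : Pred A 0ℓ} (P? : Decidable P) xs ys → count P? (xs ++ ys) ≡ count P? xs + count P? ys
  count-++ P? xs ys = trans (cong length (filter-++ P? xs ys)) (length-++ (filter P? xs))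

  count≤length : ∀ {A : Set} {P : Pred A 0ℓ} (P? : Decidable P) xs → count P? xs ≤ length xs
  count≤length P? = length-filter P?

  count-≐ : ∀ {A : Set} {P Q : Pred A 0ℓ} (P? : Decidable P) (Q? : Decidable Q) → P ≐ Q → ∀ xs → count P? xs ≡ count Q? xs
  count-≐ P? Q? P≐Q xs = cong length (filter-≐ P? Q? P≐Q xs)

  count-⊎ : ∀ {A : Set} {P Q : Pred A 0ℓ} (P? : Decidable P) (Q? : Decidable Q) → (∀ {x} → P x → ¬ Q x) →
    ∀ xs → count (λ x → P? x ⊎-dec Q? x) xs ≡ count P? xs + count Q? xs
  count-⊎ P? Q? disjoint []       = refl
  count-⊎ {P = P} {Q} P? Q? disjoint (x ∷ xs) = step (P? x) (Q? x)
    where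
    R? = λ x → P? x ⊎-dec Q? x
    open ≡-Reasoning
    step : Dec (P x) → Dec (Q x) → count R? (x ∷ xs) ≡ count P? (x ∷ xs) + count Q? (x ∷ xs)
    step (yes px) (yes qx) = ⊥-elim (disjoint px qx)
    step (yes px) (no ¬qx) = begin
      count R? (x ∷ xs)            ≡⟨ count-accept R? xs (inj₁ px) ⟩
      suc (count R? xs)            ≡⟨ cong suc (count-⊎ P? Q? disjoint xs) ⟩
      suc (count P? xs) + count Q? xs
        ≡⟨ cong₂ _+_ (count-accept P? xs px) (count-reject Q? xs ¬qx) ⟨
      count P? (x ∷ xs) + count Q? (x ∷ xs) ∎
    step (no ¬px) (yes qx) = begin
      count R? (x ∷ xs)            ≡⟨ count-accept R? xs (inj₂ qx) ⟩
      suc (count R? xs)            ≡⟨ cong suc (count-⊎ P? Q? disjoint xs) ⟩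
      suc (count P? xs + count Q? xs) ≡⟨ ℕ.+-suc (count P? xs) (count Q? xs) ⟨
      count P? xs + suc (count Q? xs)
        ≡⟨ cong₂ _+_ (count-reject P? xs ¬px) (count-accept Q? xs qx) ⟨
      count P? (x ∷ xs) + count Q? (x ∷ xs) ∎
    step (no ¬px) (no ¬qx) = begin
      count R? (x ∷ xs)            ≡⟨ count-reject R? xs [ ¬px , ¬qx ] ⟩
      count R? xs                  ≡⟨ count-⊎ P? Q? disjoint xs ⟩
      count P? xs + count Q? xs
        ≡⟨ cong₂ _+_ (count-reject P? xs ¬px) (count-reject Q? xs ¬qx) ⟨
      count P? (x ∷ xs) + count Q? (x ∷ xs) ∎

  count-map : ∀ {A B : Set} {P : Pred B 0ℓ} (P? : Decidable P) (f : A → B) xs → count P? (map f xs) ≡ count (P? ∘ f) xs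
  count-map P? f []       = refl
  count-map {P = P} P? f (x ∷ xs) = step (P? (f x))
    where
    step : Dec (P (f x)) → count P? (map f (x ∷ xs)) ≡ count (P? ∘ f) (x ∷ xs)
    step (yes p) = trans (count-accept P? (map f xs) p) (trans (cong suc (count-map P? f xs)) (sym (count-accept (P? ∘ f) xs p)))
    step (no ¬p) = trans (count-reject P? (map f xs) ¬p) (trans (count-map P? f xs) (sym (count-reject (P? ∘ f) xs ¬p)))

  count-product : ∀ {A B : Set} {P : Pred A 0ℓ} {Q : Pred B 0ℓ} (P? : Decidable P) (Q? : Decidable Q) xs ys →
    count (λ p → P? (proj₁ p) ×-dec Q? (proj₂ p)) (concatMap (λ x → map (λ y → (x , y)) ys) xs) ≡ count P? xs * count Q? ys
  count-product P? Q? []       ys = refl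
  count-product {P = P} {Q} P? Q? (x ∷ xs) ys =
    trans (count-++ R? (map (λ y → (x , y)) ys) (concatMap (λ x → map (λ y → (x , y)) ys) xs))
          (trans (cong (_+_ (count R? (map (λ y → (x , y)) ys))) (count-product P? Q? xs ys)) (row (P? x)))
    where
    R? = λ p → P? (proj₁ p) ×-dec Q? (proj₂ p)
    open ≡-Reasoning
    row : Dec (P x) → count R? (map (λ y → (x , y)) ys) + count P? xs * count Q? ys ≡ count P? (x ∷ xs) * count Q? ys
    row (yes px) = begin
      count R? (map (λ y → (x , y)) ys) + count P? xs * count Q? ys
        ≡⟨ cong (_+ count P? xs * count Q? ys) (trans (count-map R? (λ y → (x , y)) ys) (count-≐ _ Q? (proj₂ , (px ,_)) ys)) ⟩
      suc (count P? xs) * count Q? ys  ≡⟨ cong (_* count Q? ys) (count-accept P? xs px) ⟨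
      count P? (x ∷ xs) * count Q? ys  ∎
    row (no ¬px) = begin
      count R? (map (λ y → (x , y)) ys) + count P? xs * count Q? ys
        ≡⟨ cong (_+ count P? xs * count Q? ys) (trans (count-map R? (λ y → (x , y)) ys)
             (cong length (filter-none _ (universal (λ _ → ¬px ∘ proj₁) ys)))) ⟩
      count P? xs * count Q? ys        ≡⟨ cong (_* count Q? ys) (count-reject P? xs ¬px) ⟨
      count P? (x ∷ xs) * count Q? ys  ∎

  run : ℤ → ℕ → List ℤ
  run s zero    = []
  run s (suc k) = s ∷ run (ℤ.suc s) k

  length-run : ∀ s k → length (run s k) ≡ k
  length-run s zero    = refl
  length-run s (suc k) = cong suc (length-run (ℤ.suc s) k)

  run-∷ʳ : ∀ s k → run s (suc k) ≡ run s k ++ (+ k ℤ.+ s) ∷ []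
  run-∷ʳ s zero    = cong (_∷ []) (sym (ℤ.+-identityˡ s))
  run-∷ʳ s (suc k) = cong (s ∷_) (trans (run-∷ʳ (ℤ.suc s) k) (cong (λ t → run (ℤ.suc s) k ++ t ∷ []) (shift (+ k) s)))
    where
    shift : ∀ (k s : ℤ) → k ℤ.+ (+ 1 ℤ.+ s) ≡ + 1 ℤ.+ k ℤ.+ s
    shift = ℤ-Solver.solve-∀

  applyUpTo-run : ∀ (f : ℕ → ℤ) k → (∀ i → f (suc i) ≡ ℤ.suc (f i)) → applyUpTo f k ≡ run (f 0) k
  applyUpTo-run f zero    _      = refl
  applyUpTo-run f (suc k) f-step =
    cong (f 0 ∷_) (trans (applyUpTo-run (f ∘ suc) k (f-step ∘ suc)) (cong (λ s → run s k) (f-step 0)))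

  interval-run : ∀ n → interval n ≡ run (+ 0 ℤ.- + n) (suc (2 * n))
  interval-run n = trans (map-upTo (λ i → + i ℤ.- + n) (suc (2 * n)))
    (applyUpTo-run (λ i → + i ℤ.- + n) (suc (2 * n)) (λ i → step (+ i) (+ n)))
    where
    step : ∀ (i n : ℤ) → + 1 ℤ.+ i ℤ.- n ≡ + 1 ℤ.+ (i ℤ.- n)
    step = ℤ-Solver.solve-∀

  count-rotate : ∀ {A : Set} {P : Pred A 0ℓ} (P? : Decidable P) {x y} → (P x → P y) → (P y → P x) →
    ∀ xs → count P? (x ∷ xs) ≡ count P? (xs ++ y ∷ [])
  count-rotate {P = P} P? {x} {y} x⇒y y⇒x xs = trans (step (P? x)) (sym (count-++ P? xs (y ∷ [])))
    where
    step : Dec (P x) → count P? (x ∷ xs) ≡ count P? xs + count P? (y ∷ [])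
    step (yes px) = trans (count-accept P? xs px) (trans (sym (ℕ.+-comm (count P? xs) 1))
                      (cong (_+_ (count P? xs)) (sym (count-accept P? [] (x⇒y px)))))
    step (no ¬px) = trans (count-reject P? xs ¬px) (trans (sym (ℕ.+-identityʳ (count P? xs)))
                      (cong (_+_ (count P? xs)) (sym (count-reject P? [] (¬px ∘ y⇒x)))))

  shift-invariant⇒constant : (f : ℤ → ℕ) → (∀ s → f s ≡ f (ℤ.suc s)) → ∀ s → f s ≡ f 0ℤ
  shift-invariant⇒constant f inv (+ zero)       = refl
  shift-invariant⇒constant f inv (+ suc k)      = trans (sym (inv (+ k))) (shift-invariant⇒constant f inv (+ k))
  shift-invariant⇒constant f inv -[1+ zero ]    = inv -[1+ zero ]
  shift-invariant⇒constant f inv -[1+ suc k ]   = trans (inv -[1+ suc k ]) (shift-invariant⇒constant f inv -[1+ k ])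

  -- A window of k consecutive integers loses its first element and gains its (k+1)-st, and a k-periodic
  -- predicate cannot tell them apart.
  periodic-window-count : ∀ {P : Pred ℤ 0ℓ} (P? : Decidable P) k →
    (∀ {x} → P x → P (+ k ℤ.+ x)) → (∀ {x} → P (+ k ℤ.+ x) → P x) →
    ∀ s → count P? (run s k) ≡ count P? (run 0ℤ k)
  periodic-window-count P? zero    _ _ s = refl
  periodic-window-count {P} P? (suc k) forward backward =
    shift-invariant⇒constant (λ s → count P? (run s (suc k)))
      (λ s → trans (count-rotate P? (λ p → subst P (last≡ s) (forward p)) (λ p → backward (subst P (sym (last≡ s)) p))
                                 (run (ℤ.suc s) k))
                   (cong (count P?) (sym (run-∷ʳ (ℤ.suc s) k))))
    where
    last≡ : ∀ s → + suc k ℤ.+ s ≡ + k ℤ.+ ℤ.suc s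
    last≡ s = shift (+ k) s
      where
      shift : ∀ (k s : ℤ) → + 1 ℤ.+ k ℤ.+ s ≡ k ℤ.+ (+ 1 ℤ.+ s)
      shift = ℤ-Solver.solve-∀

  run-split : ∀ s k m → ∃[ s′ ] run s (k + m) ≡ run s k ++ run s′ m
  run-split s zero    m = s , refl
  run-split s (suc k) m = let s′ , eq = run-split (ℤ.suc s) k m in s′ , cong (s ∷_) eq

  count-run≤length : ∀ {P : Pred ℤ 0ℓ} (P? : Decidable P) s m → count P? (run s m) ≤ m
  count-run≤length P? s m = subst (count P? (run s m) ≤_) (length-run s m) (count≤length P? (run s m))

  short-run-bounds : ∀ {P : Pred ℤ 0ℓ} (P? : Decidable P) s {m} → m ≤ 5 →
    6 * count P? (run s m) ≤ m + 30 × m ≤ 6 * count P? (run s m) + 5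
  short-run-bounds P? s {m} m≤5 =
    ℕ.≤-trans (ℕ.*-monoʳ-≤ 6 (ℕ.≤-trans (count-run≤length P? s m) m≤5)) (ℕ.m≤n+m 30 m) ,
    ℕ.≤-trans m≤5 (ℕ.m≤n+m 5 _)

  6-window-bounds : ∀ {P : Pred ℤ 0ℓ} (P? : Decidable P) → (∀ s → count P? (run s 6) ≡ 1) →
    ∀ m s → 6 * count P? (run s m) ≤ m + 30 × m ≤ 6 * count P? (run s m) + 5
  6-window-bounds P? one 0 s = short-run-bounds P? s (ℕ.m≤m+n 0 5)
  6-window-bounds P? one 1 s = short-run-bounds P? s (ℕ.m≤m+n 1 4)
  6-window-bounds P? one 2 s = short-run-bounds P? s (ℕ.m≤m+n 2 3)
  6-window-bounds P? one 3 s = short-run-bounds P? s (ℕ.m≤m+n 3 2)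
  6-window-bounds P? one 4 s = short-run-bounds P? s (ℕ.m≤m+n 4 1)
  6-window-bounds P? one 5 s = short-run-bounds P? s (ℕ.m≤m+n 5 0)
  6-window-bounds P? one (suc (suc (suc (suc (suc (suc m)))))) s =
    let s′ , split = run-split s 6 m
        upper , lower = 6-window-bounds P? one m s′
        c≡ = trans (cong (count P?) split) (trans (count-++ P? (run s 6) (run s′ m)) (cong (_+ count P? (run s′ m)) (one s)))
    in subst (λ c → 6 * c ≤ 6 + m + 30 × 6 + m ≤ 6 * c + 5) (sym c≡)
         (subst (λ k → k ≤ 6 + m + 30 × 6 + m ≤ k + 5) (sym (ℕ.*-distribˡ-+ 6 1 (count P? (run s′ m))))
           (ℕ.+-monoʳ-≤ 6 upper , ℕ.+-monoʳ-≤ 6 lower))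

  residue? : (g : ℤ) → Decidable (λ x → + 6 ∣ x ℤ.- g)
  residue? g x = + 6 ∣? x ℤ.- g

  residues : ℤ → ℕ → ℕ
  residues g n = count (residue? g) (interval n)

  residues-differ : ∀ {x g h} → + 6 ∣ x ℤ.- g → + 6 ∣ x ℤ.- h → + 6 ∣ h ℤ.- g
  residues-differ {x} {g} {h} 6∣x-g 6∣x-h = subst (+ 6 ∣_) (difference x g h) (∣m∣n⇒∣m-n 6∣x-g 6∣x-h)
    where
    difference : ∀ (x g h : ℤ) → x ℤ.- g ℤ.- (x ℤ.- h) ≡ h ℤ.- g
    difference = ℤ-Solver.solve-∀

  coset-count : ∀ g n → count (inCoset6? g) (box n) ≡ residues (proj₁ g) n * residues (proj₂ g) n
  coset-count (gx , gy) n =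
    trans (count-≐ (inCoset6? (gx , gy)) (λ p → residue? gx (proj₁ p) ×-dec residue? gy (proj₂ p))
                   ((λ { {_ , _} p∈ → p∈ }) , (λ { {_ , _} p∈ → p∈ })) (box n))
          (count-product (residue? gx) (residue? gy) (interval n) (interval n))

  B₁₂-count : ∀ n → countIn B₁₂ B₁₂? n ≡
    residues (+ 1) n * residues (+ 0) n + (residues (+ 0) n * residues (+ 1) n + residues (- + 1) n * residues (- + 1) n)
  B₁₂-count n = begin
    count B₁₂? (box n)
      ≡⟨ count-⊎ (inCoset6? g₁) (λ p → inCoset6? g₂ p ⊎-dec inCoset6? g₃ p) (λ {p} → g₁∉g₂∪g₃ {p}) (box n) ⟩
    count (inCoset6? g₁) (box n) + count (λ p → inCoset6? g₂ p ⊎-dec inCoset6? g₃ p) (box n)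
      ≡⟨ cong (_+_ (count (inCoset6? g₁) (box n))) (count-⊎ (inCoset6? g₂) (inCoset6? g₃) (λ {p} → g₂∉g₃ {p}) (box n)) ⟩
    count (inCoset6? g₁) (box n) + (count (inCoset6? g₂) (box n) + count (inCoset6? g₃) (box n))
      ≡⟨ cong₂ _+_ (coset-count g₁ n) (cong₂ _+_ (coset-count g₂ n) (coset-count g₃ n)) ⟩
    residues (+ 1) n * residues (+ 0) n + (residues (+ 0) n * residues (+ 1) n + residues (- + 1) n * residues (- + 1) n) ∎
    where
    open ≡-Reasoning
    g₁ g₂ g₃ : Pt
    g₁ = (+ 1 , + 0)
    g₂ = (+ 0 , + 1)
    g₃ = (- + 1 , - + 1)
    g₁∉g₂∪g₃ : ∀ {p} → InCoset6 g₁ p → ¬ (InCoset6 g₂ p ⊎ InCoset6 g₃ p)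
    g₁∉g₂∪g₃ {x , _} (x∈ , _) (inj₁ (x∈′ , _)) =
      toWitnessFalse {a? = + 6 ∣? + 0 ℤ.- + 1} _ (residues-differ {x} {+ 1} {+ 0} x∈ x∈′)
    g₁∉g₂∪g₃ {x , _} (x∈ , _) (inj₂ (x∈′ , _)) =
      toWitnessFalse {a? = + 6 ∣? - + 1 ℤ.- + 1} _ (residues-differ {x} {+ 1} { - + 1} x∈ x∈′)
    g₂∉g₃ : ∀ {p} → InCoset6 g₂ p → ¬ InCoset6 g₃ p
    g₂∉g₃ {x , _} (x∈ , _) (x∈′ , _) =
      toWitnessFalse {a? = + 6 ∣? - + 1 ℤ.- + 0} _ (residues-differ {x} {+ 0} { - + 1} x∈ x∈′)

  residue-window : ∀ g → count (residue? g) (run 0ℤ 6) ≡ 1 → ∀ s → count (residue? g) (run s 6) ≡ 1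
  residue-window g base s =
    trans (periodic-window-count (residue? g) 6 (λ {x} → forward {x}) (λ {x} → backward {x}) s) base
    where
    shift : ∀ (x g : ℤ) → + 6 ℤ.+ (x ℤ.- g) ≡ + 6 ℤ.+ x ℤ.- g
    shift = ℤ-Solver.solve-∀
    forward : ∀ {x} → + 6 ∣ x ℤ.- g → + 6 ∣ + 6 ℤ.+ x ℤ.- g
    forward {x} 6∣x-g = subst (+ 6 ∣_) (shift x g) (∣m∣n⇒∣m+n ∣-refl 6∣x-g)
    backward : ∀ {x} → + 6 ∣ + 6 ℤ.+ x ℤ.- g → + 6 ∣ x ℤ.- g
    backward {x} 6∣6+x-g = ∣m+n∣m⇒∣n (subst (+ 6 ∣_) (sym (shift x g)) 6∣6+x-g) ∣-refl

  ApproxSixth : ℕ → ℕ → Set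
  ApproxSixth m a = 6 * a ≤ m + 30 × m ≤ 6 * a + 5 × a ≤ m

  residue-bounds : ∀ g → count (residue? g) (run 0ℤ 6) ≡ 1 → ∀ n → ApproxSixth (suc (2 * n)) (residues g n)
  residue-bounds g base n = subst (λ xs → ApproxSixth (suc (2 * n)) (count (residue? g) xs)) (sym (interval-run n))
    (let upper , lower = 6-window-bounds (residue? g) (residue-window g base) (suc (2 * n)) s
     in upper , lower , count-run≤length (residue? g) s (suc (2 * n)))
    where s = + 0 ℤ.- + n

  module _ where
    open ℕ.≤-Reasoning

    count-upper : ∀ m a b c .{{_ : ℕ.NonZero m}} → ApproxSixth m a → ApproxSixth m b → ApproxSixth m c →
      12 * (a * b + (b * a + c * c)) ≤ m * m + 960 * m
    count-upper m a b c (6a≤ , _) (6b≤ , _) (6c≤ , _) = begin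
      12 * (a * b + (b * a + c * c))
        ≤⟨ ℕ.*-cancelˡ-≤ 3 (begin
             3 * (12 * (a * b + (b * a + c * c)))                ≡⟨ sixes a b c ⟩
             6 * a * (6 * b) + (6 * b * (6 * a) + 6 * c * (6 * c))
               ≤⟨ ℕ.+-mono-≤ (ℕ.*-mono-≤ 6a≤ 6b≤) (ℕ.+-mono-≤ (ℕ.*-mono-≤ 6b≤ 6a≤) (ℕ.*-mono-≤ 6c≤ 6c≤)) ⟩
             (m + 30) * (m + 30) + ((m + 30) * (m + 30) + (m + 30) * (m + 30)) ≡⟨ thrice (m + 30) ⟩
             3 * ((m + 30) * (m + 30))                           ∎) ⟩
      (m + 30) * (m + 30)                ≡⟨ square m ⟩
      m * m + 60 * m + 900               ≤⟨ ℕ.+-monoʳ-≤ (m * m + 60 * m) (ℕ.m≤m*n 900 m) ⟩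
      m * m + 60 * m + 900 * m           ≡⟨ collect m ⟩
      m * m + 960 * m                    ∎
      where
      sixes : ∀ a b c → 3 * (12 * (a * b + (b * a + c * c))) ≡ 6 * a * (6 * b) + (6 * b * (6 * a) + 6 * c * (6 * c))
      sixes = ℕ-solve-∀
      thrice : ∀ x → x * x + (x * x + x * x) ≡ 3 * (x * x)
      thrice = ℕ-solve-∀
      square : ∀ m → (m + 30) * (m + 30) ≡ m * m + 60 * m + 900
      square = ℕ-solve-∀
      collect : ∀ m → m * m + 60 * m + 900 * m ≡ m * m + 960 * m
      collect = ℕ-solve-∀

    count-lower : ∀ m a b c .{{_ : ℕ.NonZero m}} → ApproxSixth m a → ApproxSixth m b → ApproxSixth m c →
      m * m ≤ 12 * (a * b + (b * a + c * c)) + 960 * m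
    count-lower m a b c (_ , m≤a , a≤m) (_ , m≤b , b≤m) (_ , m≤c , c≤m) = begin
      m * m
        ≤⟨ ℕ.*-cancelˡ-≤ 3 (begin
             3 * (m * m)                                            ≡⟨ thrice m ⟨
             m * m + (m * m + m * m)
               ≤⟨ ℕ.+-mono-≤ (ℕ.*-mono-≤ m≤a m≤b) (ℕ.+-mono-≤ (ℕ.*-mono-≤ m≤b m≤a) (ℕ.*-mono-≤ m≤c m≤c)) ⟩
             (6 * a + 5) * (6 * b + 5) + ((6 * b + 5) * (6 * a + 5) + (6 * c + 5) * (6 * c + 5)) ≡⟨ expand a b c ⟩
             3 * X + (60 * a + 60 * b + 60 * c + 75)
               ≤⟨ ℕ.+-monoʳ-≤ (3 * X) (ℕ.+-mono-≤ (ℕ.+-mono-≤ (ℕ.+-mono-≤ (ℕ.*-monoʳ-≤ 60 a≤m) (ℕ.*-monoʳ-≤ 60 b≤m))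
                    (ℕ.*-monoʳ-≤ 60 c≤m)) (ℕ.m≤m*n 75 m)) ⟩
             3 * X + (60 * m + 60 * m + 60 * m + 75 * m)           ≡⟨ collect X m ⟩
             3 * (X + 85 * m)                                       ∎) ⟩
      X + 85 * m                  ≤⟨ ℕ.+-monoʳ-≤ X (ℕ.*-monoˡ-≤ m (ℕ.m≤m+n 85 875)) ⟩
      X + 960 * m                 ∎
      where
      X = 12 * (a * b + (b * a + c * c))
      thrice : ∀ x → x * x + (x * x + x * x) ≡ 3 * (x * x)
      thrice = ℕ-solve-∀
      expand : ∀ a b c → (6 * a + 5) * (6 * b + 5) + ((6 * b + 5) * (6 * a + 5) + (6 * c + 5) * (6 * c + 5))
        ≡ 3 * (12 * (a * b + (b * a + c * c))) + (60 * a + 60 * b + 60 * c + 75)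
      expand = ℕ-solve-∀
      collect : ∀ X m → 3 * X + (60 * m + 60 * m + 60 * m + 75 * m) ≡ 3 * (X + 85 * m)
      collect = ℕ-solve-∀

  Converges : (ℕ → ℚ) → ℚ → Set
  Converges f L = ∀ ε → 0ℚ <ℚ ε → ∃[ N ] ∀ n → N ≤ n → L -ℚ ε ≤ℚ f n × f n ≤ℚ L +ℚ ε

  limit⇒limsup : ∀ {f L} → Converges f L → LimsupEq f L
  limit⇒limsup f→L =
    (λ ε ε>0 → let N , close = f→L ε ε>0 in N , λ n N≤n → proj₂ (close n N≤n)) ,
    (λ ε ε>0 N → let M , close = f→L ε ε>0 in N + M , ℕ.m≤m+n N M , proj₁ (close (N + M) (ℕ.m≤n+m M N)))

  -- Both comparisons are cross-multiplications of the unnormalised representatives.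
  fraction-upper : ∀ C M p d .(c : Coprime (suc p) (suc d)) → C * (12 * suc d) ≤ (suc d + suc p * 12) * suc M →
    + C / suc M ≤ℚ + 1 / 12 +ℚ mkℚ +[1+ p ] d c
  fraction-upper C M p d c h =
    ℚ.toℚᵘ-cancel-≤ (ℚᵘ.≤-respʳ-≃ (ℚᵘ.≃-sym (ℚ.toℚᵘ-homo-+ (+ 1 / 12) (mkℚ +[1+ p ] d c)))
      (ℚᵘ.≤-respˡ-≃ (ℚᵘ.≃-sym (ℚ.toℚᵘ-fromℚᵘ (mkℚᵘ (+ C) M)))
        (*≤* (subst₂ ℤ._≤_ (ℤ.pos-* C (12 * suc d)) (cong (λ t → + ((t + suc p * 12) * suc M)) (sym (ℕ.*-identityˡ (suc d))))
               (+≤+ h)))))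

  fraction-lower : ∀ C M p d .(c : Coprime (suc p) (suc d)) → suc d * suc M ≤ C * (12 * suc d) + suc p * 12 * suc M →
    + 1 / 12 -ℚ mkℚ +[1+ p ] d c ≤ℚ + C / suc M
  fraction-lower C M p d c h =
    ℚ.toℚᵘ-cancel-≤ (ℚᵘ.≤-respˡ-≃ (ℚᵘ.≃-sym (ℚ.toℚᵘ-homo-+ (+ 1 / 12) (ℚ.- mkℚ +[1+ p ] d c)))
      (ℚᵘ.≤-respʳ-≃ (ℚᵘ.≃-sym (ℚ.toℚᵘ-fromℚᵘ (mkℚᵘ (+ C) M)))
        (*≤* (subst₂ ℤ._≤_ (sym (numerator (+ suc d) (+ suc p) (+ suc M))) (ℤ.pos-* C (12 * suc d))
               (subtract (suc d * suc M) (C * (12 * suc d)) (suc p * 12 * suc M) h)))))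
    where
    numerator : ∀ (D P M : ℤ) → (+ 1 ℤ.* D ℤ.+ ℤ.- P ℤ.* + 12) ℤ.* M ≡ D ℤ.* M ℤ.- P ℤ.* + 12 ℤ.* M
    numerator = ℤ-Solver.solve-∀
    subtract : ∀ a b e → a ≤ b + e → + a ℤ.- + e ℤ.≤ + b
    subtract a b e a≤b+e = subst (+ a ℤ.- + e ℤ.≤_) (cancel (+ b) (+ e)) (ℤ.+-monoˡ-≤ (ℤ.- + e) (+≤+ a≤b+e))
      where
      cancel : ∀ (b e : ℤ) → b ℤ.+ e ℤ.- e ≡ b
      cancel = ℤ-Solver.solve-∀

  module _ where
    open ℕ.≤-Reasoning

    error-term : ∀ K m sd sp → K * sd ≤ m → K * m * sd ≤ suc sp * 12 * (m * m)
    error-term K m sd sp K*sd≤m = begin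
      K * m * sd               ≡⟨ rearrange K m sd ⟩
      m * (K * sd)             ≤⟨ ℕ.*-monoʳ-≤ m K*sd≤m ⟩
      m * m                    ≤⟨ ℕ.m≤n*m (m * m) (suc sp * 12) ⟩
      suc sp * 12 * (m * m)    ∎
      where
      rearrange : ∀ K m sd → K * m * sd ≡ m * (K * sd)
      rearrange = ℕ-solve-∀

    upper-estimate : ∀ C m K sd sp → 12 * C ≤ m * m + K * m → K * sd ≤ m →
      C * (12 * sd) ≤ (sd + suc sp * 12) * (m * m)
    upper-estimate C m K sd sp 12C≤ K*sd≤m = begin
      C * (12 * sd)                              ≡⟨ regroup C sd ⟩
      12 * C * sd                                ≤⟨ ℕ.*-monoˡ-≤ sd 12C≤ ⟩
      (m * m + K * m) * sd                       ≡⟨ expand m K sd ⟩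
      sd * (m * m) + K * m * sd                  ≤⟨ ℕ.+-monoʳ-≤ (sd * (m * m)) (error-term K m sd sp K*sd≤m) ⟩
      sd * (m * m) + suc sp * 12 * (m * m)       ≡⟨ ℕ.*-distribʳ-+ (m * m) sd (suc sp * 12) ⟨
      (sd + suc sp * 12) * (m * m)               ∎
      where
      regroup : ∀ C sd → C * (12 * sd) ≡ 12 * C * sd
      regroup = ℕ-solve-∀
      expand : ∀ m K sd → (m * m + K * m) * sd ≡ sd * (m * m) + K * m * sd
      expand = ℕ-solve-∀

    lower-estimate : ∀ C m K sd sp → m * m ≤ 12 * C + K * m → K * sd ≤ m →
      sd * (m * m) ≤ C * (12 * sd) + suc sp * 12 * (m * m)
    lower-estimate C m K sd sp m*m≤ K*sd≤m = begin
      sd * (m * m)                               ≤⟨ ℕ.*-monoʳ-≤ sd m*m≤ ⟩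
      sd * (12 * C + K * m)                      ≡⟨ expand C m K sd ⟩
      C * (12 * sd) + K * m * sd                 ≤⟨ ℕ.+-monoʳ-≤ (C * (12 * sd)) (error-term K m sd sp K*sd≤m) ⟩
      C * (12 * sd) + suc sp * 12 * (m * m)      ∎
      where
      expand : ∀ C m K sd → sd * (12 * C + K * m) ≡ C * (12 * sd) + K * m * sd
      expand = ℕ-solve-∀

  ratio-converges : ∀ (X : Subset) (X? : Decidable X) K →
    (∀ n → 12 * countIn X X? n ≤ suc (2 * n) * suc (2 * n) + K * suc (2 * n)) →
    (∀ n → suc (2 * n) * suc (2 * n) ≤ 12 * countIn X X? n + K * suc (2 * n)) →
    Converges (ratio X X?) (+ 1 / 12)
  ratio-converges X X? K upper lower (mkℚ (+ zero) d c) (ℚ.*<* (+<+ ()))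
  ratio-converges X X? K upper lower (mkℚ -[1+ _ ] d c) (ℚ.*<* ())
  ratio-converges X X? K upper lower (mkℚ +[1+ p ] d c) _ = K * suc d , λ n K*sd≤n →
    let K*sd≤m = ℕ.≤-trans K*sd≤n (ℕ.≤-trans (ℕ.m≤m+n n (n + 0)) (ℕ.n≤1+n (2 * n)))
    in fraction-lower (countIn X X? n) _ p d c (lower-estimate (countIn X X? n) (suc (2 * n)) K (suc d) p (lower n) K*sd≤m) ,
       fraction-upper (countIn X X? n) _ p d c (upper-estimate (countIn X X? n) (suc (2 * n)) K (suc d) p (upper n) K*sd≤m)

  B₁₂-density : UpperDensityEq B₁₂ B₁₂? (+ 1 / 12)
  B₁₂-density = limit⇒limsup {L = + 1 / 12} (ratio-converges B₁₂ B₁₂? 960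
    (λ n → subst (λ C → 12 * C ≤ m n * m n + 960 * m n) (sym (B₁₂-count n)) (count-upper (m n) _ _ _ (a n) (b n) (c n)))
    (λ n → subst (λ C → m n * m n ≤ 12 * C + 960 * m n) (sym (B₁₂-count n)) (count-lower (m n) _ _ _ (a n) (b n) (c n))))
    where
    m : ℕ → ℕ
    m n = suc (2 * n)
    a : ∀ n → ApproxSixth (m n) (residues (+ 1) n)
    a = residue-bounds (+ 1) refl
    b : ∀ n → ApproxSixth (m n) (residues (+ 0) n)
    b = residue-bounds (+ 0) refl
    c : ∀ n → ApproxSixth (m n) (residues (- + 1) n)
    c = residue-bounds (- + 1) refl

open Stability using (B₁₂-B-stable; B₁₂-not-I-stable)
open Density using (B₁₂-density)

proposition3p12 : B-stable B₁₂ × ¬ I-stable B₁₂ × UpperDensityEq B₁₂ B₁₂? (+ 1 / 12)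
proposition3p12 = B₁₂-B-stable , B₁₂-not-I-stable , B₁₂-density
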